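{- If $G$ is a bipartite graph with maximum degree $\Delta(G)=4$, then $G$ is cyclically interval colorable and $w_c(G)=4$.
   Context: All graphs are finite and undirected; multiple edges are allowed, loops are not. A proper $t$-edge coloring of $G$ is a map $\alpha:E(G)\to\{1,\dots,t\}$ with $\alpha(e)\neq\alpha(e')$ for adjacent edges $e,e'$; $S(v,\alpha)$ is the set of colors on edges incident to $v$. A proper $t$-edge coloring $\alpha$ is a cyclic interval $t$-coloring if for every vertex $v$, either $S(v,\alpha)$ or $\{1,\dots,t\}\setminus S(v,\alpha)$ is a set of consecutive integers. A graph is cyclically interval colorable if it has a cyclic interval $t$-coloring for some positive integer $t$, and then $w_c(G)$ denotes the least such $t$. -}

module Defs where

open import Data.Nat using (ℕ; _≤_; _<_)
open import Data.Fin using (Fin)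
open import Data.Fin.Properties using (_≟_)
open import Data.Bool using (Bool)
open import Data.Product using (Σ; ∃; ∃-syntax; _×_; proj₁; proj₂)
open import Data.Sum using (_⊎_)
open import Data.List using (List; length; filter)
open import Data.List.Base using (allFin)
open import Relation.Nullary using (¬_; Dec)
open import Relation.Nullary.Decidable using (_⊎-dec_)
open import Relation.Binary.PropositionalEquality using (_≡_; _≢_)
open import Function.Bundles using (_⇔_)

-- A finite multigraph (no loops) on vertex set Fin n with edge set Fin m;
-- each edge has two (distinct) endpoints. Parallel edges are allowed.
record Graph : Set where
  field
    n      : ℕ
    m      : ℕ
    ends   : Fin m → Fin n × Fin n
    noLoop : ∀ e → proj₁ (ends e) ≢ proj₂ (ends e)

module _ (G : Graph) where
  open Graph G

  Incident : Fin m → Fin n → Set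
  Incident e v = (proj₁ (ends e) ≡ v) ⊎ (proj₂ (ends e) ≡ v)

  incident? : ∀ e v → Dec (Incident e v)
  incident? e v = (proj₁ (ends e) ≟ v) ⊎-dec (proj₂ (ends e) ≟ v)

  degree : Fin n → ℕ
  degree v = length (filter (λ e → incident? e v) (allFin m))

  MaxDegree : ℕ → Set
  MaxDegree d = (∀ v → degree v ≤ d) × (∃[ v ] degree v ≡ d)

  Bipartite : Set
  Bipartite = Σ (Fin n → Bool) λ side →
    ∀ e → side (proj₁ (ends e)) ≢ side (proj₂ (ends e))

  Adjacent : Fin m → Fin m → Set
  Adjacent e e′ = e ≢ e′ × (∃[ v ] Incident e v × Incident e′ v)

  IsProperColoring : ℕ → (Fin m → ℕ) → Set
  IsProperColoring t α =
    (∀ e → 1 ≤ α e × α e ≤ t) × (∀ e e′ → Adjacent e e′ → α e ≢ α e′)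

  InS : (Fin m → ℕ) → Fin n → ℕ → Set
  InS α v c = ∃[ e ] Incident e v × α e ≡ c

  -- a predicate on {1..t} describes a set of consecutive integers
  -- (the empty set is allowed, taking a > b)
  ConsecutiveIn : ℕ → (ℕ → Set) → Set
  ConsecutiveIn t P =
    ∃[ a ] ∃[ b ] (∀ c → 1 ≤ c → c ≤ t → (P c ⇔ (a ≤ c × c ≤ b)))

  IsCyclicIntervalColoring : ℕ → (Fin m → ℕ) → Set
  IsCyclicIntervalColoring t α =
    IsProperColoring t α ×
    (∀ v → ConsecutiveIn t (InS α v) ⊎ ConsecutiveIn t (λ c → ¬ InS α v c))

  HasCyclicIntervalColoring : ℕ → Set
  HasCyclicIntervalColoring t = ∃[ α ] IsCyclicIntervalColoring t α

  CyclicallyIntervalColorable : Set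
  CyclicallyIntervalColorable = ∃[ t ] 1 ≤ t × HasCyclicIntervalColoring t

  Wc≡ : ℕ → Set
  Wc≡ k = 1 ≤ k × HasCyclicIntervalColoring k ×
          (∀ t → 1 ≤ t → t < k → ¬ HasCyclicIntervalColoring t)

module Submission where

-- Splitting off pairs of edges at a vertex shows that every multigraph has an orientation
-- in which the in- and out-degree of each vertex differ by at most one.  In a bipartite
-- graph, colouring each edge by the side of its tail turns this into a 2-edge-colouring
-- that is balanced at every vertex.  Balance all edges into classes x and ¬x, then balance
-- x into colours 1, 3 and ¬x into colours 2, 4.  At a vertex of degree at most 4 every
-- colour then occurs at most once, and the only subsets of {1,2,3,4} that are neither
-- cyclic intervals nor complements of one, {1,3} and {2,4}, lie inside one class of the
-- first split, which its balance forbids.  Conversely, a vertex of degree 4 needs four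
-- colours in any proper edge colouring.

open import Defs
open import Data.Bool using (Bool; true; false; T; not; _∧_; if_then_else_)
open import Data.Bool.Properties using (T-∧; T-≡; ∨-comm; ∧-assoc; not-injective)
open import Data.Fin using (Fin; zero; suc)
open import Data.Fin.Properties using (any?; 0≢1+n) renaming (_≟_ to _≟ᶠ_; suc-injective to Fin-suc-injective)
open import Data.List using (length; filter; tabulate)
open import Data.Nat using (ℕ; zero; suc; _+_; _≤_; _<_; z≤n; s≤s; z<s; _≡ᵇ_; _<ᵇ_; _≤ᵇ_)
open import Data.Nat.Properties
  using (+-assoc; +-comm; +-suc; +-mono-≤; +-monoʳ-≤; ≤-refl; ≤-reflexive; ≤-trans; ≤-pred; ≤-total;
         m≤n+m; m≤n⇒m≤1+n; n≤0⇒n≡0; suc-injective; <⇒≱; ≤∧≢⇒<;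
         ≡ᵇ⇒≡; ≡⇒≡ᵇ; <ᵇ⇒<; <⇒<ᵇ; ≤ᵇ⇒≤; ≤⇒≤ᵇ; +-commutativeSemigroup; module ≤-Reasoning)
open import Algebra.Properties.CommutativeSemigroup +-commutativeSemigroup using (x∙yz≈y∙xz; interchange)
open import Data.Product using (∃-syntax; _×_; _,_; proj₁; proj₂; swap)
open import Data.Product.Properties using (swap-involutive)
open import Data.Sum using (_⊎_; inj₁; inj₂)
import Data.Sum as Sum
open import Data.Vec.Functional using (updateAt)
open import Data.Vec.Functional.Properties using (updateAt-updates; updateAt-minimal; updateAt-commutes)
open import Function using (_∘_; const; _⇔_; mk⇔; Equivalence)
open import Function.Properties.Equivalence using () renaming (trans to ⇔-trans)
open import Relation.Binary.Definitions using (DecidableEquality)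
open import Relation.Binary.PropositionalEquality
  using (_≡_; _≢_; _≗_; refl; sym; trans; cong; cong₂; subst; subst₂; ≢-sym; module ≡-Reasoning)
open import Relation.Nullary using (¬_; Dec; yes; no; does; contradiction)
open import Relation.Nullary.Decidable using (_⊎-dec_; _×-dec_; T?)

T-does : {A : Set} (a? : Dec A) → T (does a?) ⇔ A
T-does (yes a) = mk⇔ (const a) (const _)
T-does (no ¬a) = mk⇔ (λ ()) ¬a

module Counting where

  private
    variable
      m : ℕ
      s s′ : Bool
      p q r S S′ : Fin m → Bool

  ⟦_⟧ : Bool → ℕ
  ⟦ true  ⟧ = 1
  ⟦ false ⟧ = 0

  ⟦⟧-mono : (T s → T s′) → ⟦ s ⟧ ≤ ⟦ s′ ⟧
  ⟦⟧-mono {false} _ = z≤n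
  ⟦⟧-mono {true}  {true}  _ = ≤-refl
  ⟦⟧-mono {true}  {false} s⇒s′ = contradiction (s⇒s′ _) λ ()

  count : (Fin m → Bool) → ℕ
  count {zero}  p = 0
  count {suc m} p = ⟦ p zero ⟧ + count (p ∘ suc)

  count-cong : p ≗ q → count p ≡ count q
  count-cong {zero}  _  = refl
  count-cong {suc m} eq = cong₂ _+_ (cong ⟦_⟧ (eq zero)) (count-cong (eq ∘ suc))

  count-mono : (∀ i → T (p i) → T (q i)) → count p ≤ count q
  count-mono {zero}  _   = z≤n
  count-mono {suc m} p⇒q = +-mono-≤ (⟦⟧-mono (p⇒q zero)) (count-mono (p⇒q ∘ suc))

  count≡0 : (∀ i → ¬ T (p i)) → count p ≡ 0
  count≡0 {zero}          _  = refl
  count≡0 {suc m} {p} ¬p with p zero in eq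
  ... | true  = contradiction (subst T (sym eq) _) (¬p zero)
  ... | false = count≡0 (¬p ∘ suc)

  count>0 : ∀ i → T (p i) → 0 < count p
  count>0 {p = p} zero    pᵢ with p zero
  ... | true = s≤s z≤n
  count>0 {p = p} (suc i) pᵢ = ≤-trans (count>0 i pᵢ) (m≤n+m _ ⟦ p zero ⟧)

  count≥2 : ∀ {i j} → i ≢ j → T (p i) → T (p j) → 2 ≤ count p
  count≥2 {i = zero}  {zero}  i≢j _  _  = contradiction refl i≢j
  count≥2 {p = p} {zero}  {suc j} _ pᵢ pⱼ with p zero
  ... | true = s≤s (count>0 j pⱼ)
  count≥2 {p = p} {suc i} {zero}  _ pᵢ pⱼ with p zero
  ... | true = s≤s (count>0 i pᵢ)
  count≥2 {p = p} {suc i} {suc j} i≢j pᵢ pⱼ =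
    ≤-trans (count≥2 (i≢j ∘ cong suc) pᵢ pⱼ) (m≤n+m _ ⟦ p zero ⟧)

  count-witness : 0 < count p → ∃[ i ] T (p i)
  count-witness {suc m} {p} pos with p zero in eq
  ... | true  = zero , subst T (sym eq) _
  ... | false = let (i , pᵢ) = count-witness pos in suc i , pᵢ

  count≤1 : (∀ i j → T (p i) → T (p j) → i ≡ j) → count p ≤ 1
  count≤1 {zero}  _ = z≤n
  count≤1 {suc m} {p} unique with p zero in eq
  ... | true  = ≤-reflexive (cong suc (count≡0 λ i pᵢ →
                  0≢1+n (unique zero (suc i) (subst T (sym eq) _) pᵢ)))
  ... | false = count≤1 λ i j pᵢ pⱼ → Fin-suc-injective (unique (suc i) (suc j) pᵢ pⱼ)

  infixl 6 _∩_ _─_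

  _∩_ : (Fin m → Bool) → (Fin m → Bool) → Fin m → Bool
  (S ∩ r) i = S i ∧ r i

  ∁ : (Fin m → Bool) → Fin m → Bool
  ∁ S i = not (S i)

  _─_ : (Fin m → Bool) → Fin m → Fin m → Bool
  S ─ e = updateAt S e (const false)

  ∈─⇒≢ : ∀ {e i} → T ((S ─ e) i) → i ≢ e
  ∈─⇒≢ {S = S} {e} i∈ refl = subst T (updateAt-updates e S) i∈

  ∈─⇒∈ : ∀ {e i} → T ((S ─ e) i) → T (S i)
  ∈─⇒∈ {S = S} {e} {i} i∈ = subst T (updateAt-minimal i e S (∈─⇒≢ i∈)) i∈

  ∈⇒∈─ : ∀ {e i} → i ≢ e → T (S i) → T ((S ─ e) i)
  ∈⇒∈─ {S = S} {e} {i} i≢e = subst T (sym (updateAt-minimal i e S i≢e))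

  countIn : (Fin m → Bool) → (Fin m → Bool) → ℕ
  countIn S q = count (λ i → S i ∧ q i)

  ∣_∣ : (Fin m → Bool) → ℕ
  ∣ S ∣ = countIn S (const true)

  countIn-congˡ : S ≗ S′ → countIn S q ≡ countIn S′ q
  countIn-congˡ {q = q} eq = count-cong λ i → cong (_∧ q i) (eq i)

  countIn-congʳ : (∀ i → T (S i) → q i ≡ r i) → countIn S q ≡ countIn S r
  countIn-congʳ {S = S} eq = count-cong λ i → lemma (S i) (eq i)
    where
    lemma : ∀ {x y} s → (T s → x ≡ y) → s ∧ x ≡ s ∧ y
    lemma true  eq = eq _
    lemma false _  = refl

  countIn-monoˡ : (∀ i → T (S i) → T (S′ i)) → countIn S q ≤ countIn S′ q
  countIn-monoˡ S⊆S′ = count-mono λ i Sq →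
    let (Sᵢ , qᵢ) = Equivalence.to T-∧ Sq in Equivalence.from T-∧ (S⊆S′ i Sᵢ , qᵢ)

  countIn≤∣∣ : countIn S q ≤ ∣ S ∣
  countIn≤∣∣ {S = S} {q = q} = count-mono λ i Sq →
    Equivalence.from (T-∧ {S i}) (proj₁ (Equivalence.to (T-∧ {S i} {q i}) Sq) , _)

  countIn-split : ∀ (S r q : Fin m → Bool) → countIn S q ≡ countIn (S ∩ r) q + countIn (S ∩ ∁ r) q
  countIn-split {zero}  S r q = refl
  countIn-split {suc m} S r q = begin
    ⟦ S zero ∧ q zero ⟧ + countIn (S ∘ suc) (q ∘ suc)
      ≡⟨ cong₂ _+_ (split (S zero) (r zero) (q zero)) (countIn-split (S ∘ suc) (r ∘ suc) (q ∘ suc)) ⟩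
    (⟦ (S zero ∧ r zero) ∧ q zero ⟧ + ⟦ (S zero ∧ not (r zero)) ∧ q zero ⟧) +
    (countIn ((S ∩ r) ∘ suc) (q ∘ suc) + countIn ((S ∩ ∁ r) ∘ suc) (q ∘ suc))
      ≡⟨ interchange ⟦ (S zero ∧ r zero) ∧ q zero ⟧ ⟦ (S zero ∧ not (r zero)) ∧ q zero ⟧ _ _ ⟩
    countIn (S ∩ r) q + countIn (S ∩ ∁ r) q ∎
    where
    open ≡-Reasoning
    split : ∀ s r q → ⟦ s ∧ q ⟧ ≡ ⟦ (s ∧ r) ∧ q ⟧ + ⟦ (s ∧ not r) ∧ q ⟧
    split false _     _ = refl
    split true  true  q = sym (+-comm ⟦ q ⟧ 0)
    split true  false q = refl

  countIn-if : ∀ b (A B : Fin m → Bool) →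
               countIn S (λ i → if b then A i else B i) ≡ (if b then countIn S A else countIn S B)
  countIn-if true  _ _ = refl
  countIn-if false _ _ = refl

  countIn-─ : ∀ (S q : Fin m → Bool) e → countIn S q ≡ ⟦ S e ∧ q e ⟧ + countIn (S ─ e) q
  countIn-─ {suc m} S q zero    = refl
  countIn-─ {suc m} S q (suc e) =
    trans (cong (⟦ S zero ∧ q zero ⟧ +_) (countIn-─ (S ∘ suc) (q ∘ suc) e))
          (x∙yz≈y∙xz ⟦ S zero ∧ q zero ⟧ ⟦ S (suc e) ∧ q (suc e) ⟧ _)

  countIn-─∈ : ∀ {e} → T (S e) → countIn S q ≡ ⟦ q e ⟧ + countIn (S ─ e) q
  countIn-─∈ {S = S} {q} {e} e∈S =
    trans (countIn-─ S q e) (cong (λ s → ⟦ s ∧ q e ⟧ + countIn (S ─ e) q) (Equivalence.to T-≡ e∈S))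

  ∣─∣ : ∀ {e k} → T (S e) → ∣ S ∣ ≡ suc k → ∣ S ─ e ∣ ≡ k
  ∣─∣ {S = S} e∈S ∣S∣≡1+k = suc-injective (trans (sym (countIn-─∈ {S = S} e∈S)) ∣S∣≡1+k)

  ∣∣>0⇒∃∈ : 0 < ∣ S ∣ → ∃[ i ] T (S i)
  ∣∣>0⇒∃∈ {S = S} ∣S∣>0 =
    let (i , Sᵢ∧true) = count-witness ∣S∣>0 in i , proj₁ (Equivalence.to (T-∧ {S i}) Sᵢ∧true)

  length-filter-tabulate : ∀ {A : Set} {P : A → Set} (P? : ∀ x → Dec (P x)) (f : Fin m → A) →
                           length (filter P? (tabulate f)) ≡ count (λ i → does (P? (f i)))
  length-filter-tabulate {zero}  P? f = refl
  length-filter-tabulate {suc m} P? f with does (P? (f zero))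
  ... | true  = cong suc (length-filter-tabulate P? (f ∘ suc))
  ... | false = length-filter-tabulate P? (f ∘ suc)

open Counting

infix 4 _≈₁_

_≈₁_ : ℕ → ℕ → Set
x ≈₁ y = x ≤ suc y × y ≤ suc x

≈₁-sym : ∀ {x y} → x ≈₁ y → y ≈₁ x
≈₁-sym (x≤1+y , y≤1+x) = y≤1+x , x≤1+y

≈₁-+ : ∀ k {x y} → x ≈₁ y → k + x ≈₁ k + y
≈₁-+ k {x} {y} (x≤1+y , y≤1+x) =
  subst (k + x ≤_) (+-suc k y) (+-monoʳ-≤ k x≤1+y) ,
  subst (k + y ≤_) (+-suc k x) (+-monoʳ-≤ k y≤1+x)

≈₁-if : ∀ b {x y} → x ≈₁ y → (if b then x else y) ≈₁ (if not b then x else y)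
≈₁-if true  x≈y = x≈y
≈₁-if false x≈y = ≈₁-sym x≈y

module BalancedOrientation {V : Set} (_≟_ : DecidableEquality V) where

  infix 4 _⇄_ _∈ₑ_ _∈ₑ?_

  private
    variable
      m : ℕ
      S S′ : Fin m → Bool
      u v w : V
      x y : V × V
      e e₁ e₂ : Fin m
      f g : Fin m → V
      d d′ ends : Fin m → V × V

  _⇄_ : V × V → V × V → Set
  x ⇄ y = x ≡ y ⊎ x ≡ swap y

  _∈ₑ_ : V → V × V → Set
  v ∈ₑ x = proj₁ x ≡ v ⊎ proj₂ x ≡ v

  _∈ₑ?_ : ∀ v x → Dec (v ∈ₑ x)
  v ∈ₑ? x = (proj₁ x ≟ v) ⊎-dec (proj₂ x ≟ v)

  ⇄-sym : x ⇄ y → y ⇄ x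
  ⇄-sym (inj₁ refl) = inj₁ refl
  ⇄-sym (inj₂ refl) = inj₂ (sym (swap-involutive _))

  ⇄-swapˡ : x ⇄ y → swap x ⇄ y
  ⇄-swapˡ (inj₁ refl) = inj₂ refl
  ⇄-swapˡ (inj₂ refl) = inj₁ (swap-involutive _)

  ⇄-loop : x ⇄ y → proj₁ y ≡ proj₂ y → proj₁ x ≡ proj₂ x
  ⇄-loop (inj₁ refl) loop = loop
  ⇄-loop (inj₂ refl) loop = sym loop

  ⇄-∈ₑ : x ⇄ y → v ∈ₑ x → v ∈ₑ y
  ⇄-∈ₑ (inj₁ refl) = λ v∈ → v∈
  ⇄-∈ₑ (inj₂ refl) = Sum.swap

  ∈ₑ?-⇄ : x ⇄ y → does (v ∈ₑ? x) ≡ does (v ∈ₑ? y)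
  ∈ₑ?-⇄ (inj₁ refl) = refl
  ∈ₑ?-⇄ {y = y} {v} (inj₂ refl) = ∨-comm (does (proj₂ y ≟ v)) (does (proj₁ y ≟ v))

  ∈ₑ⇒⇄ : v ∈ₑ x → ∃[ w ] x ⇄ (v , w)
  ∈ₑ⇒⇄ {x = (_ , w)} (inj₁ refl) = w , inj₁ refl
  ∈ₑ⇒⇄ {x = (w , _)} (inj₂ refl) = w , inj₂ refl

  Reorients : (Fin m → V × V) → (Fin m → V × V) → Set
  Reorients ends d = ∀ e → d e ⇄ ends e

  reorients-updateAt : (∀ i → i ≢ e → d i ⇄ ends i) → x ⇄ ends e →
                       Reorients ends (updateAt d e (const x))
  reorients-updateAt {e = e} {d = d} {ends = ends} others x⇄ i with i ≟ᶠ e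
  ... | yes refl = subst (_⇄ ends i) (sym (updateAt-updates i d)) x⇄
  ... | no  i≢e  = subst (_⇄ ends i) (sym (updateAt-minimal i e d i≢e)) (others i i≢e)

  δ : V → V → ℕ
  δ u v = ⟦ does (u ≟ v) ⟧

  multiplicity : (Fin m → Bool) → (Fin m → V) → V → ℕ
  multiplicity S f v = countIn S (λ e → does (f e ≟ v))

  Balanced : (Fin m → Bool) → (Fin m → V × V) → Set
  Balanced S d = ∀ v → multiplicity S (proj₁ ∘ d) v ≈₁ multiplicity S (proj₂ ∘ d) v

  BalancedReorientation : (Fin m → V × V) → (Fin m → Bool) → Set
  BalancedReorientation ends S = ∃[ d ] Reorients ends d × Balanced S d

  multiplicity-─ : T (S e) → multiplicity S f v ≡ δ (f e) v + multiplicity (S ─ e) f v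
  multiplicity-─ {S = S} {f = f} {v = v} = countIn-─∈ {S = S} {q = λ i → does (f i ≟ v)}

  multiplicity-cong : (∀ i → T (S i) → f i ≡ g i) → multiplicity S f v ≡ multiplicity S g v
  multiplicity-cong {v = v} f≡g = countIn-congʳ λ i i∈S → cong (λ u → does (u ≟ v)) (f≡g i i∈S)

  balanced-updateAt : T (S e) →
    (∀ v → δ (proj₁ x) v + multiplicity (S ─ e) (proj₁ ∘ d) v ≈₁
           δ (proj₂ x) v + multiplicity (S ─ e) (proj₂ ∘ d) v) →
    Balanced S (updateAt d e (const x))
  balanced-updateAt {S = S} {e = e} {x = x} {d = d} e∈S bal v =
    subst₂ _≈₁_ (sym (after-update proj₁)) (sym (after-update proj₂)) (bal v)
    where
    after-update : (g : V × V → V) →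
      multiplicity S (g ∘ updateAt d e (const x)) v ≡ δ (g x) v + multiplicity (S ─ e) (g ∘ d) v
    after-update g = trans (multiplicity-─ {S = S} {f = g ∘ updateAt d e (const x)} e∈S)
      (cong₂ _+_ (cong (λ y → δ (g y) v) (updateAt-updates e d))
                 (multiplicity-cong λ i i∈ → cong g (updateAt-minimal i e d (∈─⇒≢ i∈))))

  balanced-shift : (k : V → ℕ) →
    (∀ v → multiplicity S (proj₁ ∘ d) v ≡ k v + multiplicity S′ (proj₁ ∘ d′) v) →
    (∀ v → multiplicity S (proj₂ ∘ d) v ≡ k v + multiplicity S′ (proj₂ ∘ d′) v) →
    Balanced S′ d′ → Balanced S d
  balanced-shift k tails heads bal v = subst₂ _≈₁_ (sym (tails v)) (sym (heads v)) (≈₁-+ (k v) (bal v))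

  loop-step : T (S e) → proj₁ (ends e) ≡ proj₂ (ends e) → Reorients ends d →
              Balanced (S ─ e) d → Balanced S d
  loop-step {S = S} {e = e} {d = d} e∈S loop d⇄ =
    balanced-shift {S = S} {d = d} {S′ = S ─ e} {d′ = d} (δ (proj₁ (d e)))
    (λ v → multiplicity-─ {S = S} {f = proj₁ ∘ d} e∈S)
    (λ v → trans (multiplicity-─ {S = S} {f = proj₂ ∘ d} e∈S)
                 (cong (λ u → δ u v + multiplicity (S ─ e) (proj₂ ∘ d) v) (sym (⇄-loop (d⇄ e) loop))))

  ≈₁-pendant : (O I : V → ℕ) → u ≢ w → O w ≡ 0 → I w ≡ 0 → O u ≤ I u →
               (∀ v → O v ≈₁ I v) → ∀ v → δ u v + O v ≈₁ δ w v + I v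
  ≈₁-pendant {u} {w} O I u≢w Ow≡0 Iw≡0 Ou≤Iu bal v with u ≟ v | w ≟ v
  ... | yes refl | yes refl = contradiction refl u≢w
  ... | yes refl | no _     = s≤s Ou≤Iu , m≤n⇒m≤1+n (proj₂ (bal v))
  ... | no _     | yes refl rewrite Ow≡0 | Iw≡0 = z≤n , s≤s z≤n
  ... | no _     | no _     = bal v

  pendant-step : T (S e) → proj₁ (ends e) ≢ proj₂ (ends e) →
                 (∀ i → T ((S ─ e) i) → ¬ proj₂ (ends e) ∈ₑ ends i) →
                 Reorients ends d′ → Balanced (S ─ e) d′ → BalancedReorientation ends S
  pendant-step {S = S} {e = e} {ends = ends} {d′ = d′} e∈S a≢b b-pendant d′⇄ bal =
    orient (≤-total (O a) (I a))
    where
    a b : V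
    a = proj₁ (ends e)
    b = proj₂ (ends e)
    O I : V → ℕ
    O = multiplicity (S ─ e) (proj₁ ∘ d′)
    I = multiplicity (S ─ e) (proj₂ ∘ d′)
    untouched : (g : V × V → V) → (∀ {x} → g x ≡ b → b ∈ₑ x) →
                multiplicity (S ─ e) (g ∘ d′) b ≡ 0
    untouched g b∈ = count≡0 λ i hit →
      let (i∈ , gᵢ≡b) = Equivalence.to (T-∧ {(S ─ e) i}) hit in
      b-pendant i i∈ (⇄-∈ₑ (d′⇄ i) (b∈ (Equivalence.to (T-does (g (d′ i) ≟ b)) gᵢ≡b)))
    Ob≡0 : O b ≡ 0
    Ob≡0 = untouched proj₁ inj₁
    Ib≡0 : I b ≡ 0
    Ib≡0 = untouched proj₂ inj₂
    orient : O a ≤ I a ⊎ I a ≤ O a → BalancedReorientation ends S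
    orient (inj₁ Oa≤Ia) =
      updateAt d′ e (const (a , b)) , reorients-updateAt (λ i _ → d′⇄ i) (inj₁ refl) ,
      balanced-updateAt {d = d′} e∈S (≈₁-pendant O I a≢b Ob≡0 Ib≡0 Oa≤Ia bal)
    orient (inj₂ Ia≤Oa) =
      updateAt d′ e (const (b , a)) , reorients-updateAt (λ i _ → d′⇄ i) (inj₂ refl) ,
      balanced-updateAt {d = d′} e∈S
        (≈₁-sym ∘ ≈₁-pendant I O a≢b Ib≡0 Ob≡0 Ia≤Oa (≈₁-sym ∘ bal))

  multiplicity-reroute : ∀ {x₁ x₂} → e₂ ≢ e₁ → T (S e₁) → T (S e₂) → d′ e₁ ≡ y →
    (g : V × V → V) → δ (g x₁) v + δ (g x₂) v ≡ δ w v + δ (g y) v →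
    multiplicity S (g ∘ updateAt (updateAt d′ e₁ (const x₁)) e₂ (const x₂)) v ≡
    δ w v + multiplicity (S ─ e₂) (g ∘ d′) v
  multiplicity-reroute {e₂ = e₂} {e₁ = e₁} {S = S} {d′ = d′} {y = y} {v = v} {w = w} {x₁} {x₂}
                       e₂≢e₁ e₁∈S e₂∈S d′e₁≡y g local = begin
    multiplicity S (g ∘ d″) v
      ≡⟨ multiplicity-─ {S = S} {f = g ∘ d″} e₁∈S ⟩
    δ (g (d″ e₁)) v + multiplicity (S ─ e₁) (g ∘ d″) v
      ≡⟨ cong (δ (g (d″ e₁)) v +_)
              (multiplicity-─ {S = S ─ e₁} {f = g ∘ d″} (∈⇒∈─ e₂≢e₁ e₂∈S)) ⟩
    δ (g (d″ e₁)) v + (δ (g (d″ e₂)) v + multiplicity (S ─ e₁ ─ e₂) (g ∘ d″) v)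
      ≡⟨ sym (+-assoc (δ (g (d″ e₁)) v) _ _) ⟩
    (δ (g (d″ e₁)) v + δ (g (d″ e₂)) v) + multiplicity (S ─ e₁ ─ e₂) (g ∘ d″) v
      ≡⟨ cong₂ _+_ pair rest ⟩
    (δ w v + δ (g (d′ e₁)) v) + multiplicity (S ─ e₂ ─ e₁) (g ∘ d′) v
      ≡⟨ +-assoc (δ w v) _ _ ⟩
    δ w v + (δ (g (d′ e₁)) v + multiplicity (S ─ e₂ ─ e₁) (g ∘ d′) v)
      ≡⟨ cong (δ w v +_)
              (sym (multiplicity-─ {S = S ─ e₂} {f = g ∘ d′} (∈⇒∈─ (≢-sym e₂≢e₁) e₁∈S))) ⟩
    δ w v + multiplicity (S ─ e₂) (g ∘ d′) v ∎
    where
    open ≡-Reasoning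
    d″ : Fin _ → V × V
    d″ = updateAt (updateAt d′ e₁ (const x₁)) e₂ (const x₂)
    pair : δ (g (d″ e₁)) v + δ (g (d″ e₂)) v ≡ δ w v + δ (g (d′ e₁)) v
    pair = begin
      δ (g (d″ e₁)) v + δ (g (d″ e₂)) v
        ≡⟨ cong₂ (λ p q → δ (g p) v + δ (g q) v)
                 (trans (updateAt-minimal e₁ e₂ _ (≢-sym e₂≢e₁)) (updateAt-updates e₁ d′))
                 (updateAt-updates e₂ _) ⟩
      δ (g x₁) v + δ (g x₂) v
        ≡⟨ local ⟩
      δ w v + δ (g y) v
        ≡⟨ cong (λ p → δ w v + δ (g p) v) (sym d′e₁≡y) ⟩
      δ w v + δ (g (d′ e₁)) v ∎
    rest : multiplicity (S ─ e₁ ─ e₂) (g ∘ d″) v ≡ multiplicity (S ─ e₂ ─ e₁) (g ∘ d′) v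
    rest = trans (multiplicity-cong {S = S ─ e₁ ─ e₂} λ i i∈ →
                    cong g (trans (updateAt-minimal i e₂ _ (∈─⇒≢ i∈))
                                  (updateAt-minimal i e₁ d′ (∈─⇒≢ (∈─⇒∈ {S = S ─ e₁} i∈)))))
                 (countIn-congˡ (updateAt-commutes e₂ e₁ e₂≢e₁ S))

  -- Orienting the path e₁ e₂ through w along the shortcut d′ e₁ adds one tail and one head
  -- at w and changes nothing elsewhere.
  reroute : ∀ {x₁ x₂ z} → e₂ ≢ e₁ → T (S e₁) → T (S e₂) →
    Reorients (updateAt ends e₁ (const z)) d′ → d′ e₁ ≡ y → x₁ ⇄ ends e₁ → x₂ ⇄ ends e₂ →
    (∀ v → δ (proj₁ x₁) v + δ (proj₁ x₂) v ≡ δ w v + δ (proj₁ y) v) →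
    (∀ v → δ (proj₂ x₁) v + δ (proj₂ x₂) v ≡ δ w v + δ (proj₂ y) v) →
    Balanced (S ─ e₂) d′ → BalancedReorientation ends S
  reroute {e₂ = e₂} {e₁ = e₁} {S = S} {ends = ends} {d′ = d′} {w = w} {x₁ = x₁} {x₂}
          e₂≢e₁ e₁∈S e₂∈S d′⇄ d′e₁≡y x₁⇄ x₂⇄ tails heads bal =
    d″ ,
    reorients-updateAt (λ i _ → reorients-updateAt others x₁⇄ i) x₂⇄ ,
    balanced-shift {S = S} {d = d″} {S′ = S ─ e₂} {d′ = d′} (δ w)
      (λ v → multiplicity-reroute e₂≢e₁ e₁∈S e₂∈S d′e₁≡y proj₁ (tails v))
      (λ v → multiplicity-reroute e₂≢e₁ e₁∈S e₂∈S d′e₁≡y proj₂ (heads v))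
      bal
    where
    d″ : Fin _ → V × V
    d″ = updateAt (updateAt d′ e₁ (const x₁)) e₂ (const x₂)
    others : ∀ i → i ≢ e₁ → d′ i ⇄ ends i
    others i i≢e₁ = subst (d′ i ⇄_) (updateAt-minimal i e₁ ends i≢e₁) (d′⇄ i)

  split-off-step : e₂ ≢ e₁ → T (S e₁) → T (S e₂) → ends e₂ ⇄ (proj₂ (ends e₁) , w) →
                   Reorients (updateAt ends e₁ (const (proj₁ (ends e₁) , w))) d′ →
                   Balanced (S ─ e₂) d′ → BalancedReorientation ends S
  split-off-step {e₁ = e₁} {ends = ends} {d′ = d′} e₂≢e₁ e₁∈S e₂∈S e₂⇄bc d′⇄ bal
    with subst (d′ e₁ ⇄_) (updateAt-updates e₁ ends) (d′⇄ e₁)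
  ... | inj₁ d′e₁≡ac = reroute e₂≢e₁ e₁∈S e₂∈S d′⇄ d′e₁≡ac (inj₁ refl) (⇄-sym e₂⇄bc)
                         (λ v → +-comm (δ (proj₁ (ends e₁)) v) _) (λ v → refl) bal
  ... | inj₂ d′e₁≡ca = reroute e₂≢e₁ e₁∈S e₂∈S d′⇄ d′e₁≡ca (inj₂ refl) (⇄-swapˡ (⇄-sym e₂⇄bc))
                         (λ v → refl) (λ v → +-comm (δ (proj₁ (ends e₁)) v) _) bal

  -- Pick e₁ = ab in S.  A loop is balanced on its own.  If another edge e₂ of S meets b, say
  -- e₂ = bc, replace the path a b c by the single edge e₁ = ac.  Otherwise b is a pendant
  -- vertex of S, and e₁ is directed so as to even out a.
  balanced-orientation-of-size : ∀ k (ends : Fin m → V × V) S → ∣ S ∣ ≡ k →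
                                 BalancedReorientation ends S
  balanced-orientation-of-size zero ends S ∣S∣≡0 =
    ends , (λ _ → inj₁ refl) ,
    λ v → subst₂ _≈₁_ (sym (empty proj₁ v)) (sym (empty proj₂ v)) (z≤n , z≤n)
    where
    empty : ∀ (g : V × V → V) v → multiplicity S (g ∘ ends) v ≡ 0
    empty g v = n≤0⇒n≡0 (subst (multiplicity S (g ∘ ends) v ≤_) ∣S∣≡0 (countIn≤∣∣ {S = S}))
  balanced-orientation-of-size (suc k) ends S ∣S∣≡1+k
    with e₁ , e₁∈S ← ∣∣>0⇒∃∈ {S = S} (subst (0 <_) (sym ∣S∣≡1+k) z<s)
    with proj₁ (ends e₁) ≟ proj₂ (ends e₁)
  ... | yes loop =
    let (d , d⇄ , bal) =
          balanced-orientation-of-size k ends (S ─ e₁) (∣─∣ {S = S} e₁∈S ∣S∣≡1+k)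
    in d , d⇄ , loop-step e₁∈S loop d⇄ bal
  ... | no a≢b with any? (λ i → T? ((S ─ e₁) i) ×-dec (proj₂ (ends e₁) ∈ₑ? ends i))
  ...   | no none =
    let (d′ , d′⇄ , bal) =
          balanced-orientation-of-size k ends (S ─ e₁) (∣─∣ {S = S} e₁∈S ∣S∣≡1+k)
    in pendant-step e₁∈S a≢b (λ i i∈ b∈ → none (i , i∈ , b∈)) d′⇄ bal
  ...   | yes (e₂ , e₂∈S─e₁ , b∈e₂) =
    let e₂∈S = ∈─⇒∈ {S = S} e₂∈S─e₁
        (c , e₂⇄bc) = ∈ₑ⇒⇄ b∈e₂
        (d′ , d′⇄ , bal) =
          balanced-orientation-of-size k (updateAt ends e₁ (const (proj₁ (ends e₁) , c)))
                                         (S ─ e₂) (∣─∣ {S = S} e₂∈S ∣S∣≡1+k)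
    in split-off-step (∈─⇒≢ {S = S} e₂∈S─e₁) e₁∈S e₂∈S e₂⇄bc d′⇄ bal

  balanced-orientation : (ends : Fin m → V × V) (S : Fin m → Bool) → BalancedReorientation ends S
  balanced-orientation ends S = balanced-orientation-of-size _ ends S refl

  degreeIn : (Fin m → V × V) → (Fin m → Bool) → V → ℕ
  degreeIn ends S v = countIn S (λ e → does (v ∈ₑ? ends e))

  tail-side : (σ : V → Bool) (t h v : V) → σ t ≢ σ h →
              σ t ∧ does (v ∈ₑ? (t , h)) ≡ (if σ v then does (t ≟ v) else does (h ≟ v))
  tail-side σ t h v σt≢σh with t ≟ v | h ≟ v
  ... | yes refl | yes refl = contradiction refl σt≢σh
  ... | yes refl | no _ with σ t
  ...   | true  = refl
  ...   | false = refl
  tail-side σ t h v σt≢σh | no _ | no _ with σ t | σ v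
  ...   | true  | true  = refl
  ...   | true  | false = refl
  ...   | false | true  = refl
  ...   | false | false = refl
  tail-side σ t h v σt≢σh | no _ | yes refl with σ t | σ h
  ...   | true  | true  = contradiction refl σt≢σh
  ...   | true  | false = refl
  ...   | false | true  = refl
  ...   | false | false = contradiction refl σt≢σh

  degree-by-tail-side : (σ : V → Bool) → (∀ e → σ (proj₁ (d e)) ≢ σ (proj₂ (d e))) →
    Reorients ends d → ∀ S v → degreeIn ends (S ∩ (σ ∘ proj₁ ∘ d)) v ≡
            (if σ v then multiplicity S (proj₁ ∘ d) v else multiplicity S (proj₂ ∘ d) v)
  degree-by-tail-side {d = d} {ends = ends} σ σ-proper d⇄ S v =
    trans (count-cong at-edge) (countIn-if {S = S} (σ v) _ _)
    where
    at-edge : ∀ e → (S e ∧ σ (proj₁ (d e))) ∧ does (v ∈ₑ? ends e) ≡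
                    S e ∧ (if σ v then does (proj₁ (d e) ≟ v) else does (proj₂ (d e) ≟ v))
    at-edge e = trans (∧-assoc (S e) _ _) (cong (S e ∧_)
      (trans (cong (σ (proj₁ (d e)) ∧_) (sym (∈ₑ?-⇄ (d⇄ e))))
             (tail-side σ (proj₁ (d e)) (proj₂ (d e)) v (σ-proper e))))

  balanced-2-colouring : (side : V → Bool) → (∀ e → side (proj₁ (ends e)) ≢ side (proj₂ (ends e))) →
    ∀ S → ∃[ x ] ∀ v → degreeIn ends (S ∩ x) v ≈₁ degreeIn ends (S ∩ ∁ x) v
  balanced-2-colouring {ends = ends} side side-proper S =
    let (d , d⇄ , bal) = balanced-orientation ends S in colour-by-tail d d⇄ bal
    where
    colour-by-tail : ∀ d → Reorients ends d → Balanced S d →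
      ∃[ x ] ∀ v → degreeIn ends (S ∩ x) v ≈₁ degreeIn ends (S ∩ ∁ x) v
    colour-by-tail d d⇄ bal = side ∘ proj₁ ∘ d , λ v →
      subst₂ _≈₁_ (sym (degree-by-tail-side side side-properᵈ d⇄ S v))
                  (sym (degree-by-tail-side (not ∘ side) (λ e → side-properᵈ e ∘ not-injective) d⇄ S v))
                  (≈₁-if (side v) (bal v))
      where
      side-properᵈ : ∀ e → side (proj₁ (d e)) ≢ side (proj₂ (d e))
      side-properᵈ e with d⇄ e
      ... | inj₁ eq = subst (λ p → side (proj₁ p) ≢ side (proj₂ p)) (sym eq) (side-proper e)
      ... | inj₂ eq = subst (λ p → side (proj₁ p) ≢ side (proj₂ p)) (sym eq) (≢-sym (side-proper e))

-- Cyclically consecutive colours lie on opposite sides of x.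
colour : Bool → Bool → Bool → ℕ
colour x y z = if x then (if y then 1 else 3) else (if z then 2 else 4)

colour-classes : ∀ x y z →
  (colour x y z ≡ᵇ 1) ≡ x ∧ y × (colour x y z ≡ᵇ 2) ≡ not x ∧ z ×
  (colour x y z ≡ᵇ 3) ≡ x ∧ not y × (colour x y z ≡ᵇ 4) ≡ not x ∧ not z
colour-classes true  true  _     = refl , refl , refl , refl
colour-classes true  false _     = refl , refl , refl , refl
colour-classes false _     true  = refl , refl , refl , refl
colour-classes false _     false = refl , refl , refl , refl

colour-range : ∀ x y z → 1 ≤ colour x y z × colour x y z ≤ 4
colour-range true  true  _     = s≤s z≤n , s≤s z≤n
colour-range true  false _     = s≤s z≤n , s≤s (s≤s (s≤s z≤n))
colour-range false _     true  = s≤s z≤n , s≤s (s≤s z≤n)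
colour-range false _     false = s≤s z≤n , s≤s (s≤s (s≤s (s≤s z≤n)))

≈₁-half : ∀ {a b} k → a ≈₁ b → a + b ≤ k + k → a ≤ k
≈₁-half {zero}                _       _            _  = z≤n
≈₁-half {suc zero}    {zero}  zero    _            ()
≈₁-half {suc zero}    {zero}  (suc k) _            _  = s≤s z≤n
≈₁-half {suc (suc a)} {zero}  _       (s≤s () , _) _
≈₁-half {suc a}       {suc b} zero    _            ()
≈₁-half {suc a} {suc b} (suc k) (s≤s a≤1+b , s≤s b≤1+a) (s≤s a+1+b≤k+1+k) =
  s≤s (≈₁-half k (a≤1+b , b≤1+a) (≤-pred (subst₂ _≤_ (+-suc a b) (+-suc k k) a+1+b≤k+1+k)))

at-most-one-each : ∀ {n₁ n₂ n₃ n₄} → n₁ + n₃ ≈₁ n₂ + n₄ → n₁ ≈₁ n₃ → n₂ ≈₁ n₄ →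
                   (n₁ + n₃) + (n₂ + n₄) ≤ 4 → n₁ ≤ 1 × n₂ ≤ 1 × n₃ ≤ 1 × n₄ ≤ 1
at-most-one-each {n₁} {n₂} {n₃} {n₄} odd≈even n₁≈n₃ n₂≈n₄ total≤4 =
  ≈₁-half 1 n₁≈n₃ odd≤2 ,
  ≈₁-half 1 n₂≈n₄ even≤2 ,
  ≈₁-half 1 (≈₁-sym n₁≈n₃) (subst (_≤ 2) (+-comm n₁ n₃) odd≤2) ,
  ≈₁-half 1 (≈₁-sym n₂≈n₄) (subst (_≤ 2) (+-comm n₂ n₄) even≤2)
  where
  odd≤2 : n₁ + n₃ ≤ 2
  odd≤2 = ≈₁-half 2 odd≈even total≤4
  even≤2 : n₂ + n₄ ≤ 2
  even≤2 = ≈₁-half 2 (≈₁-sym odd≈even) (subst (_≤ 4) (+-comm (n₁ + n₃) _) total≤4)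

alternating : Bool → Bool × Bool × Bool × Bool
alternating b = b , not b , b , not b

no-alternation : ∀ n₁ n₂ n₃ n₄ → n₁ + n₃ ≈₁ n₂ + n₄ →
                 ((0 <ᵇ n₁) , (0 <ᵇ n₂) , (0 <ᵇ n₃) , (0 <ᵇ n₄)) ≢ alternating true
no-alternation zero    _       _       _       _ ()
no-alternation (suc _) (suc _) _       _       _ ()
no-alternation (suc _) zero    zero    _       _ ()
no-alternation (suc _) zero    (suc _) (suc _) _ ()
no-alternation (suc a) zero    (suc b) zero    (s≤s a+1+b≤0 , _) _ =
  contradiction (≤-trans (m≤n+m (suc b) a) a+1+b≤0) λ ()

record Indicator (P : ℕ → Set) (b₁ b₂ b₃ b₄ : Bool) : Set where
  constructor indicator
  field
    at-1 : P 1 ⇔ T b₁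
    at-2 : P 2 ⇔ T b₂
    at-3 : P 3 ⇔ T b₃
    at-4 : P 4 ⇔ T b₄

T-not⇒¬T : ∀ {b} → T (not b) → ¬ T b
T-not⇒¬T {false} _ ()

¬-⇔-not : ∀ {A : Set} {b} → (A ⇔ T b) → (¬ A) ⇔ T (not b)
¬-⇔-not {b = true}  A⇔b = mk⇔ (λ ¬a → ¬a (Equivalence.from A⇔b _)) λ ()
¬-⇔-not {b = false} A⇔b = mk⇔ (λ _ → _) (λ _ → Equivalence.to A⇔b)

¬-Indicator : ∀ {P b₁ b₂ b₃ b₄} → Indicator P b₁ b₂ b₃ b₄ →
              Indicator (¬_ ∘ P) (not b₁) (not b₂) (not b₃) (not b₄)
¬-Indicator (indicator χ₁ χ₂ χ₃ χ₄) =
  indicator (¬-⇔-not χ₁) (¬-⇔-not χ₂) (¬-⇔-not χ₃) (¬-⇔-not χ₄)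

inside : ℕ → ℕ → ℕ → Bool
inside a b c = (a ≤ᵇ c) ∧ (c ≤ᵇ b)

T-inside : ∀ a b c → T (inside a b c) ⇔ (a ≤ c × c ≤ b)
T-inside a b c = mk⇔
  (λ a≤c≤b → let (a≤c , c≤b) = Equivalence.to (T-∧ {a ≤ᵇ c}) a≤c≤b
             in ≤ᵇ⇒≤ a c a≤c , ≤ᵇ⇒≤ c b c≤b)
  (λ (a≤c , c≤b) → Equivalence.from T-∧ (≤⇒≤ᵇ a≤c , ≤⇒≤ᵇ c≤b))

module _ (G : Graph) where
  open Graph G
  open BalancedOrientation (_≟ᶠ_ {n})

  inc : Fin m → Fin n → Bool
  inc e v = does (incident? G e v)

  T-inc : ∀ {e v} → T (inc e v) ⇔ Incident G e v
  T-inc {e} {v} = T-does (incident? G e v)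

  degree≡degreeIn : ∀ v → degree G v ≡ degreeIn ends (const true) v
  degree≡degreeIn v = length-filter-tabulate (λ e → incident? G e v) (λ e → e)

  colourDegree : (Fin m → ℕ) → Fin n → ℕ → ℕ
  colourDegree β v c = degreeIn ends (λ e → β e ≡ᵇ c) v

  InS⇔colourDegree>0 : ∀ β v c → InS G β v c ⇔ 0 < colourDegree β v c
  InS⇔colourDegree>0 β v c = mk⇔
    (λ (e , e∼v , βe≡c) →
       count>0 e (Equivalence.from T-∧ (≡⇒≡ᵇ (β e) c βe≡c , Equivalence.from T-inc e∼v)))
    (λ degree>0 → let (e , hit) = count-witness degree>0
                      (βe≡c , e∼v) = Equivalence.to (T-∧ {β e ≡ᵇ c}) hit
                  in e , Equivalence.to T-inc e∼v , ≡ᵇ⇒≡ (β e) c βe≡c)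

  proper⇒colourDegree≤1 : ∀ {β} → (∀ e e′ → Adjacent G e e′ → β e ≢ β e′) →
                          ∀ v c → colourDegree β v c ≤ 1
  proper⇒colourDegree≤1 {β} β-proper v c = count≤1 same-edge
    where
    same-edge : ∀ e e′ → T ((β e ≡ᵇ c) ∧ inc e v) → T ((β e′ ≡ᵇ c) ∧ inc e′ v) → e ≡ e′
    same-edge e e′ he he′ with e ≟ᶠ e′
    ... | yes e≡e′ = e≡e′
    ... | no  e≢e′ =
      let (βe≡c , e∼v) = Equivalence.to (T-∧ {β e ≡ᵇ c}) he
          (βe′≡c , e′∼v) = Equivalence.to (T-∧ {β e′ ≡ᵇ c}) he′
      in contradiction (trans (≡ᵇ⇒≡ (β e) c βe≡c) (sym (≡ᵇ⇒≡ (β e′) c βe′≡c)))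
           (β-proper e e′ (e≢e′ , v , Equivalence.to T-inc e∼v , Equivalence.to T-inc e′∼v))

  colourDegree≤1⇒proper : ∀ {β} → (∀ e v → colourDegree β v (β e) ≤ 1) →
                          ∀ e e′ → Adjacent G e e′ → β e ≢ β e′
  colourDegree≤1⇒proper {β} colour≤1 e e′ (e≢e′ , v , e∼v , e′∼v) βe≡βe′ =
    <⇒≱ (count≥2 e≢e′ (at e (≡⇒≡ᵇ (β e) (β e) refl) e∼v)
                      (at e′ (≡⇒≡ᵇ (β e′) (β e) (sym βe≡βe′)) e′∼v))
        (colour≤1 e v)
    where
    at : ∀ i → T (β i ≡ᵇ β e) → Incident G i v → T ((β i ≡ᵇ β e) ∧ inc i v)
    at i βi≡βe i∼v = Equivalence.from T-∧ (βi≡βe , Equivalence.from T-inc i∼v)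

  degree≤colours : ∀ {t β} → IsProperColoring G t β → ∀ v → degree G v ≤ t
  degree≤colours {t} {β} (β-range , β-proper) v = begin
    degree G v                         ≡⟨ degree≡degreeIn v ⟩
    degreeIn ends (const true) v       ≤⟨ countIn-monoˡ (λ e _ → ≤⇒≤ᵇ (proj₂ (β-range e))) ⟩
    degreeIn ends (λ e → β e ≤ᵇ t) v   ≤⟨ colours-at-most t ⟩
    t                                  ∎
    where
    open ≤-Reasoning
    colours-at-most : ∀ k → degreeIn ends (λ e → β e ≤ᵇ k) v ≤ k
    colours-at-most zero = ≤-reflexive (count≡0 λ e hit →
      <⇒≱ (proj₁ (β-range e)) (≤ᵇ⇒≤ (β e) 0 (proj₁ (Equivalence.to (T-∧ {β e ≤ᵇ 0}) hit))))
    colours-at-most (suc k) = begin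
      degreeIn ends B v                                     ≡⟨ countIn-split B C _ ⟩
      degreeIn ends (B ∩ C) v + degreeIn ends (B ∩ ∁ C) v   ≤⟨ +-mono-≤ top≤1 rest≤k ⟩
      1 + k                                                 ∎
      where
      B C : Fin m → Bool
      B e = β e ≤ᵇ suc k
      C e = β e ≡ᵇ suc k
      top≤1 : degreeIn ends (B ∩ C) v ≤ 1
      top≤1 = ≤-trans (countIn-monoˡ (λ e → proj₂ ∘ Equivalence.to (T-∧ {B e})))
                      (proper⇒colourDegree≤1 β-proper v (suc k))
      below : ∀ e → T ((B ∩ ∁ C) e) → T (β e ≤ᵇ k)
      below e hit = let (βe≤1+k , βe≢1+k) = Equivalence.to (T-∧ {B e}) hit in
        ≤⇒≤ᵇ (≤-pred (≤∧≢⇒< (≤ᵇ⇒≤ (β e) (suc k) βe≤1+k)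
                            (T-not⇒¬T βe≢1+k ∘ ≡⇒≡ᵇ (β e) (suc k))))
      rest≤k : degreeIn ends (B ∩ ∁ C) v ≤ k
      rest≤k = ≤-trans (countIn-monoˡ below) (colours-at-most k)

  interval : ∀ {P b₁ b₂ b₃ b₄} → Indicator P b₁ b₂ b₃ b₄ → ∀ a b →
             (b₁ , b₂ , b₃ , b₄) ≡ (inside a b 1 , inside a b 2 , inside a b 3 , inside a b 4) →
             ConsecutiveIn G 4 P
  interval (indicator χ₁ χ₂ χ₃ χ₄) a b refl = a , b , λ where
    1 _ _ → ⇔-trans χ₁ (T-inside a b 1)
    2 _ _ → ⇔-trans χ₂ (T-inside a b 2)
    3 _ _ → ⇔-trans χ₃ (T-inside a b 3)
    4 _ _ → ⇔-trans χ₄ (T-inside a b 4)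
    (suc (suc (suc (suc (suc _))))) _ (s≤s (s≤s (s≤s (s≤s ()))))

  consecutive⊎co-consecutive : ∀ {P} b₁ b₂ b₃ b₄ → Indicator P b₁ b₂ b₃ b₄ →
    (b₁ , b₂ , b₃ , b₄) ≢ alternating true → (b₁ , b₂ , b₃ , b₄) ≢ alternating false →
    ConsecutiveIn G 4 P ⊎ ConsecutiveIn G 4 (¬_ ∘ P)
  consecutive⊎co-consecutive false false false false χ _ _    = inj₁ (interval χ 1 0 refl)
  consecutive⊎co-consecutive false false false true  χ _ _    = inj₁ (interval χ 4 4 refl)
  consecutive⊎co-consecutive false false true  false χ _ _    = inj₁ (interval χ 3 3 refl)
  consecutive⊎co-consecutive false false true  true  χ _ _    = inj₁ (interval χ 3 4 refl)
  consecutive⊎co-consecutive false true  false false χ _ _    = inj₁ (interval χ 2 2 refl)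
  consecutive⊎co-consecutive false true  false true  χ _ ¬alt = contradiction refl ¬alt
  consecutive⊎co-consecutive false true  true  false χ _ _    = inj₁ (interval χ 2 3 refl)
  consecutive⊎co-consecutive false true  true  true  χ _ _    = inj₁ (interval χ 2 4 refl)
  consecutive⊎co-consecutive true  false false false χ _ _    = inj₁ (interval χ 1 1 refl)
  consecutive⊎co-consecutive true  false false true  χ _ _    = inj₂ (interval (¬-Indicator χ) 2 3 refl)
  consecutive⊎co-consecutive true  false true  false χ ¬alt _ = contradiction refl ¬alt
  consecutive⊎co-consecutive true  false true  true  χ _ _    = inj₂ (interval (¬-Indicator χ) 2 2 refl)
  consecutive⊎co-consecutive true  true  false false χ _ _    = inj₁ (interval χ 1 2 refl)
  consecutive⊎co-consecutive true  true  false true  χ _ _    = inj₂ (interval (¬-Indicator χ) 3 3 refl)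
  consecutive⊎co-consecutive true  true  true  false χ _ _    = inj₁ (interval χ 1 3 refl)
  consecutive⊎co-consecutive true  true  true  true  χ _ _    = inj₁ (interval χ 1 4 refl)

  module CyclicColouring (bip : Bipartite G) (Δ≤4 : ∀ v → degree G v ≤ 4) where

    balanced : ∀ S → ∃[ x ] ∀ v → degreeIn ends (S ∩ x) v ≈₁ degreeIn ends (S ∩ ∁ x) v
    balanced = balanced-2-colouring (proj₁ bip) (proj₂ bip)

    x y z : Fin m → Bool
    x = proj₁ (balanced (const true))
    y = proj₁ (balanced x)
    z = proj₁ (balanced (∁ x))

    α : Fin m → ℕ
    α e = colour (x e) (y e) (z e)

    module _ (v : Fin n) where

      N : ℕ → ℕ
      N = colourDegree α v

      N₁ : N 1 ≡ degreeIn ends (x ∩ y) v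
      N₁ = countIn-congˡ λ e → proj₁ (colour-classes (x e) (y e) (z e))
      N₂ : N 2 ≡ degreeIn ends (∁ x ∩ z) v
      N₂ = countIn-congˡ λ e → proj₁ (proj₂ (colour-classes (x e) (y e) (z e)))
      N₃ : N 3 ≡ degreeIn ends (x ∩ ∁ y) v
      N₃ = countIn-congˡ λ e → proj₁ (proj₂ (proj₂ (colour-classes (x e) (y e) (z e))))
      N₄ : N 4 ≡ degreeIn ends (∁ x ∩ ∁ z) v
      N₄ = countIn-congˡ λ e → proj₂ (proj₂ (proj₂ (colour-classes (x e) (y e) (z e))))

      degreeIn-x : degreeIn ends x v ≡ N 1 + N 3
      degreeIn-x = trans (countIn-split x y _) (sym (cong₂ _+_ N₁ N₃))

      degreeIn-∁x : degreeIn ends (∁ x) v ≡ N 2 + N 4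
      degreeIn-∁x = trans (countIn-split (∁ x) z _) (sym (cong₂ _+_ N₂ N₄))

      degree-by-colour : degree G v ≡ (N 1 + N 3) + (N 2 + N 4)
      degree-by-colour = trans (degree≡degreeIn v)
        (trans (countIn-split (const true) x _) (cong₂ _+_ degreeIn-x degreeIn-∁x))

      odd≈even : N 1 + N 3 ≈₁ N 2 + N 4
      odd≈even = subst₂ _≈₁_ degreeIn-x degreeIn-∁x (proj₂ (balanced (const true)) v)

      N₁≈N₃ : N 1 ≈₁ N 3
      N₁≈N₃ = subst₂ _≈₁_ (sym N₁) (sym N₃) (proj₂ (balanced x) v)

      N₂≈N₄ : N 2 ≈₁ N 4
      N₂≈N₄ = subst₂ _≈₁_ (sym N₂) (sym N₄) (proj₂ (balanced (∁ x)) v)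

      colour-once : ∀ c → 1 ≤ c → c ≤ 4 → N c ≤ 1
      colour-once c _ _
        with at-most-one-each odd≈even N₁≈N₃ N₂≈N₄ (subst (_≤ 4) degree-by-colour (Δ≤4 v))
      colour-once 1 _ _ | N≤1 , _ , _ , _ = N≤1
      colour-once 2 _ _ | _ , N≤1 , _ , _ = N≤1
      colour-once 3 _ _ | _ , _ , N≤1 , _ = N≤1
      colour-once 4 _ _ | _ , _ , _ , N≤1 = N≤1
      colour-once (suc (suc (suc (suc (suc _))))) _ (s≤s (s≤s (s≤s (s≤s ())))) | _

      cyclic-interval-at : ConsecutiveIn G 4 (InS G α v) ⊎ ConsecutiveIn G 4 (λ c → ¬ InS G α v c)
      cyclic-interval-at = consecutive⊎co-consecutive _ _ _ _
        (indicator (present 1) (present 2) (present 3) (present 4))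
        (no-alternation (N 1) (N 2) (N 3) (N 4) odd≈even)
        (no-alternation (N 2) (N 1) (N 4) (N 3) (≈₁-sym odd≈even) ∘
         cong λ (b₁ , b₂ , b₃ , b₄) → b₂ , b₁ , b₄ , b₃)
        where
        present : ∀ c → InS G α v c ⇔ T (0 <ᵇ N c)
        present c = ⇔-trans (InS⇔colourDegree>0 α v c) (mk⇔ <⇒<ᵇ (<ᵇ⇒< 0 (N c)))

    α-cyclic : IsCyclicIntervalColoring G 4 α
    α-cyclic = ((λ e → colour-range (x e) (y e) (z e)) ,
                colourDegree≤1⇒proper (λ e v → let (1≤αe , αe≤4) = colour-range (x e) (y e) (z e) in
                                               colour-once v (α e) 1≤αe αe≤4)) ,
               cyclic-interval-at

  bipartite-Δ≤4⇒cyclic-interval-4-colouring : Bipartite G → (∀ v → degree G v ≤ 4) →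
                                              HasCyclicIntervalColoring G 4
  bipartite-Δ≤4⇒cyclic-interval-4-colouring bip Δ≤4 = α , α-cyclic
    where open CyclicColouring bip Δ≤4

corollary3 : (G : Graph) → Bipartite G → MaxDegree G 4 →
    CyclicallyIntervalColorable G × Wc≡ G 4
corollary3 G bip (Δ≤4 , v , degree-v≡4) =
  (4 , s≤s z≤n , colouring) , s≤s z≤n , colouring , fewer-colours-fail
  where
  colouring : HasCyclicIntervalColoring G 4
  colouring = bipartite-Δ≤4⇒cyclic-interval-4-colouring G bip Δ≤4
  fewer-colours-fail : ∀ t → 1 ≤ t → t < 4 → ¬ HasCyclicIntervalColoring G t
  fewer-colours-fail t _ t<4 (β , proper , _) =
    <⇒≱ t<4 (subst (_≤ t) degree-v≡4 (degree≤colours G proper v))
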